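{- For every prime $p$, the chromatic number of the 334-triangle graph of $SL_3(\mathbb{Z})$ is at most the chromatic number of the 334-triangle graph of $SL_3(\mathbb{Z}/p\mathbb{Z})$: $$\chi(\Delta 334(SL_3(\mathbb{Z}))) \le \chi(\Delta 334(SL_3(\mathbb{Z}/p\mathbb{Z}))).$$ Here both chromatic numbers are those of the graphs with the identity vertex (which carries a loop and is adjacent to no other vertex) deleted.
   Context: For a group $G$ with identity $e$, the 334-triangle graph $\Delta 334(G)$ is the undirected graph whose vertices are the elements $a\in G$ with $a^3=e$, with an edge between vertices $a$ and $b$ if and only if $(ab)^4=e$. In this graph the identity is adjacent to itself and to no other vertex, and it is the only vertex with a loop. $SL_3(R)$ denotes the group of $3\times 3$ matrices with entries in $R$ and determinant $1$. $\chi$ denotes the chromatic number (minimum number of colors in a coloring where adjacent vertices receive different colors). -}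

module Defs where

open import Data.Nat using (ℕ; _≤_; _∸_; NonZero) renaming (_+_ to _+ℕ_; _*_ to _*ℕ_)
open import Data.Nat.DivMod using (_mod_)
open import Data.Nat.Primality using (Prime; prime⇒nonZero)
open import Data.Integer as ℤ using (ℤ)
open import Data.Fin using (Fin; toℕ)
open import Data.Product using (Σ; _×_)
open import Relation.Binary.PropositionalEquality using (_≡_; _≢_)

record Ops : Set₁ where
  field
    Car : Set
    0# 1# : Car
    _+_ _*_ : Car → Car → Car
    -_ : Car → Car
  infixl 6 _+_
  infixl 7 _*_
  infix 8 -_

record M3 (A : Set) : Set where
  constructor mk
  field
    a11 a12 a13 a21 a22 a23 a31 a32 a33 : A

module _ (R : Ops) where
  open Ops R
  open M3

  I3 : M3 Car
  I3 = mk 1# 0# 0# 0# 1# 0# 0# 0# 1#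

  _·_ : M3 Car → M3 Car → M3 Car
  x · y = mk
    (a11 x * a11 y + a12 x * a21 y + a13 x * a31 y)
    (a11 x * a12 y + a12 x * a22 y + a13 x * a32 y)
    (a11 x * a13 y + a12 x * a23 y + a13 x * a33 y)
    (a21 x * a11 y + a22 x * a21 y + a23 x * a31 y)
    (a21 x * a12 y + a22 x * a22 y + a23 x * a32 y)
    (a21 x * a13 y + a22 x * a23 y + a23 x * a33 y)
    (a31 x * a11 y + a32 x * a21 y + a33 x * a31 y)
    (a31 x * a12 y + a32 x * a22 y + a33 x * a32 y)
    (a31 x * a13 y + a32 x * a23 y + a33 x * a33 y)

  det : M3 Car → Car
  det x =
      a11 x * (a22 x * a33 x + - (a23 x * a32 x))
    + - (a12 x * (a21 x * a33 x + - (a23 x * a31 x)))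
    + a13 x * (a21 x * a32 x + - (a22 x * a31 x))

  InSL3 : M3 Car → Set
  InSL3 a = det a ≡ 1#

  IsVertex : M3 Car → Set
  IsVertex a = InSL3 a × (a · (a · a)) ≡ I3 × a ≢ I3

  Adj : M3 Car → M3 Car → Set
  Adj a b = let c = a · b in (c · (c · (c · c))) ≡ I3

  -- proper k-colouring of Δ334(SL₃(R)) minus the identity
  -- (values of c on non-vertices are irrelevant)
  ProperColoring : (k : ℕ) → (M3 Car → Fin k) → Set
  ProperColoring k c = ∀ a b → IsVertex a → IsVertex b → Adj a b → c a ≢ c b

  Colorable : ℕ → Set
  Colorable k = Σ (M3 Car → Fin k) (ProperColoring k)

  IsChromaticNumber : ℕ → Set
  IsChromaticNumber n = Colorable n × (∀ m → Colorable m → n ≤ m)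

ℤOps : Ops
ℤOps = record
  { Car = ℤ ; 0# = ℤ.0ℤ ; 1# = ℤ.1ℤ ; _+_ = ℤ._+_ ; _*_ = ℤ._*_ ; -_ = ℤ.-_ }

ZModOps' : (n : ℕ) → .{{NonZero n}} → Ops
ZModOps' n = record
  { Car = Fin n
  ; 0# = 0 mod n
  ; 1# = 1 mod n
  ; _+_ = λ a b → (toℕ a +ℕ toℕ b) mod n
  ; _*_ = λ a b → (toℕ a *ℕ toℕ b) mod n
  ; -_ = λ a → (n ∸ toℕ a) mod n
  }

ZModOps : (p : ℕ) → Prime p → Ops
ZModOps p pr = ZModOps' p {{prime⇒nonZero pr}}

-- Reduction modulo p is a ring homomorphism ℤ → ℤ/p, so it maps SL₃(ℤ) into SL₃(ℤ/p), cube roots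
-- of the identity to cube roots of the identity, and edges ((ab)⁴ = I) to edges. Composing a
-- colouring of Δ334(SL₃(ℤ/p)) with it therefore colours Δ334(SL₃(ℤ)), provided no vertex other than
-- I reduces to I. That is a Minkowski-type fact: if a³ = I and a = I + qE with p ∣ q, expanding
-- (I + qE)³ = I gives 3E + q(3E² + qE³) = 0, which forces p ∣ E; so a ≡ I modulo every power
-- of p, and a = I.
module Submission where

open import Defs
open import Data.Nat using (ℕ)
open import Data.Nat.Primality using (Prime)

open import Data.Empty using (⊥-elim)
open import Data.Fin using (Fin; zero; suc; toℕ; fromℕ<; #_)
open import Data.Fin.Properties using (toℕ-fromℕ<; toℕ-injective; toℕ<n)
open import Data.Integer as ℤ using (ℤ; +_; 0ℤ; 1ℤ; _+_; _*_; -_; _-_; ∣_∣; _%ℕ_; _/ℕ_)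
open import Data.Integer.DivMod using (n%ℕd<d; a≡a%ℕn+[a/ℕn]*n)
open import Data.Integer.Divisibility.Signed
  using (_∣_; divides; quotient; module ∣-Reasoning; ∣⇒∣ᵤ; ∣ᵤ⇒∣; ∣-refl; ∣m∣n⇒∣m+n; ∣m⇒∣-m; ∣n⇒∣m*n; ∣m⇒∣m*n; *-monoˡ-∣)
import Data.Integer.Properties as ℤ
open import Data.Integer.Tactic.RingSolver using (solve-∀)
open import Data.Integer.Solver using (module +-*-Solver)
open +-*-Solver using (Polynomial; con; var; _:+_; _:*_; :-_; ⟦_⟧; ⟦_⟧↓; prove)
open import Data.Vec using (Vec; _∷_; [])
import Data.Nat as ℕ
import Data.Nat.Properties as ℕ
import Data.Nat.Divisibility as ℕ
open import Data.Nat.Primality using (prime?; prime⇒nonZero; prime⇒nonTrivial; prime⇒irreducible; euclidsLemma; ¬prime[1])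
open import Data.Product using (_,_)
open import Data.Sum using (inj₁; inj₂)
open import Function using (_∘_)
open import Relation.Binary.PropositionalEquality
open import Relation.Nullary using (yes; no)
open import Relation.Nullary.Decidable using (toWitness)
open import Algebra.Properties.AbelianGroup ℤ.+-0-abelianGroup using (∙-cancelˡ; inverseˡ-unique)

open M3

entry : ∀ {A : Set} → M3 A → Fin 3 → Fin 3 → A
entry x zero             zero             = a11 x
entry x zero             (suc zero)       = a12 x
entry x zero             (suc (suc zero)) = a13 x
entry x (suc zero)       zero             = a21 x
entry x (suc zero)       (suc zero)       = a22 x
entry x (suc zero)       (suc (suc zero)) = a23 x
entry x (suc (suc zero)) zero             = a31 x
entry x (suc (suc zero)) (suc zero)       = a32 x
entry x (suc (suc zero)) (suc (suc zero)) = a33 x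

tabulate : ∀ {A : Set} → (Fin 3 → Fin 3 → A) → M3 A
tabulate f = mk (f zero zero) (f zero (suc zero)) (f zero (suc (suc zero)))
                (f (suc zero) zero) (f (suc zero) (suc zero)) (f (suc zero) (suc (suc zero)))
                (f (suc (suc zero)) zero) (f (suc (suc zero)) (suc zero)) (f (suc (suc zero)) (suc (suc zero)))

entry-tabulate : ∀ {A : Set} (f : Fin 3 → Fin 3 → A) i j → entry (tabulate f) i j ≡ f i j
entry-tabulate f zero             zero             = refl
entry-tabulate f zero             (suc zero)       = refl
entry-tabulate f zero             (suc (suc zero)) = refl
entry-tabulate f (suc zero)       zero             = refl
entry-tabulate f (suc zero)       (suc zero)       = refl
entry-tabulate f (suc zero)       (suc (suc zero)) = refl
entry-tabulate f (suc (suc zero)) zero             = refl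
entry-tabulate f (suc (suc zero)) (suc zero)       = refl
entry-tabulate f (suc (suc zero)) (suc (suc zero)) = refl

mk-cong : ∀ {A : Set} {a1 a2 a3 a4 a5 a6 a7 a8 a9 b1 b2 b3 b4 b5 b6 b7 b8 b9 : A} →
  a1 ≡ b1 → a2 ≡ b2 → a3 ≡ b3 → a4 ≡ b4 → a5 ≡ b5 → a6 ≡ b6 → a7 ≡ b7 → a8 ≡ b8 → a9 ≡ b9 →
  mk a1 a2 a3 a4 a5 a6 a7 a8 a9 ≡ mk b1 b2 b3 b4 b5 b6 b7 b8 b9
mk-cong refl refl refl refl refl refl refl refl refl = refl

M3-ext : ∀ {A : Set} {x y : M3 A} → (∀ i j → entry x i j ≡ entry y i j) → x ≡ y
M3-ext h = mk-cong (h zero zero) (h zero (suc zero)) (h zero (suc (suc zero)))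
                   (h (suc zero) zero) (h (suc zero) (suc zero)) (h (suc zero) (suc (suc zero)))
                   (h (suc (suc zero)) zero) (h (suc (suc zero)) (suc zero)) (h (suc (suc zero)) (suc (suc zero)))

mapᴹ : ∀ {A B : Set} → (A → B) → M3 A → M3 B
mapᴹ f x = tabulate λ i j → f (entry x i j)

entry-mapᴹ : ∀ {A B : Set} (f : A → B) x i j → entry (mapᴹ f x) i j ≡ f (entry x i j)
entry-mapᴹ f x = entry-tabulate λ i j → f (entry x i j)

cube fourth : (R : Ops) → M3 (Ops.Car R) → M3 (Ops.Car R)
cube   R a = _·_ R a (_·_ R a a)
fourth R a = _·_ R a (cube R a)

I+ : (R : Ops) → Ops.Car R → M3 (Ops.Car R) → M3 (Ops.Car R)
I+ R q E = tabulate λ i j → Ops._+_ R (entry (I3 R) i j) (Ops._*_ R q (entry E i j))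

-- Ring homomorphisms and the 334-triangle graph

module _ (R S : Ops) where
  private
    module R = Ops R
    module S = Ops S

  record IsRingHomomorphism (f : R.Car → S.Car) : Set where
    field
      0#-homo : f R.0# ≡ S.0#
      1#-homo : f R.1# ≡ S.1#
      +-homo  : ∀ x y → f (x R.+ y) ≡ f x S.+ f y
      *-homo  : ∀ x y → f (x R.* y) ≡ f x S.* f y
      -‿homo  : ∀ x → f (R.- x) ≡ S.- f x

module MatrixHomomorphism {R S : Ops} {f : Ops.Car R → Ops.Car S} (hom : IsRingHomomorphism R S f) where
  open IsRingHomomorphism hom
  private
    module R = Ops R
    module S = Ops S

  mapᴹ-I3 : mapᴹ f (I3 R) ≡ I3 S
  mapᴹ-I3 = mk-cong 1#-homo 0#-homo 0#-homo 0#-homo 1#-homo 0#-homo 0#-homo 0#-homo 1#-homo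

  homo-dot : ∀ a b c d e g →
    f (a R.* b R.+ c R.* d R.+ e R.* g) ≡ f a S.* f b S.+ f c S.* f d S.+ f e S.* f g
  homo-dot a b c d e g = trans (+-homo _ _)
    (cong₂ S._+_ (trans (+-homo _ _) (cong₂ S._+_ (*-homo a b) (*-homo c d))) (*-homo e g))

  mapᴹ-· : ∀ x y → mapᴹ f (_·_ R x y) ≡ _·_ S (mapᴹ f x) (mapᴹ f y)
  mapᴹ-· x y = mk-cong (homo-dot _ _ _ _ _ _) (homo-dot _ _ _ _ _ _) (homo-dot _ _ _ _ _ _)
                       (homo-dot _ _ _ _ _ _) (homo-dot _ _ _ _ _ _) (homo-dot _ _ _ _ _ _)
                       (homo-dot _ _ _ _ _ _) (homo-dot _ _ _ _ _ _) (homo-dot _ _ _ _ _ _)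

  homo-cofactor : ∀ a b c d e →
    f (a R.* (b R.* c R.+ R.- (d R.* e))) ≡ f a S.* (f b S.* f c S.+ S.- (f d S.* f e))
  homo-cofactor a b c d e = trans (*-homo a _)
    (cong (f a S.*_) (trans (+-homo _ _) (cong₂ S._+_ (*-homo b c) (trans (-‿homo _) (cong S.-_ (*-homo d e))))))

  homo-det : ∀ x → f (det R x) ≡ det S (mapᴹ f x)
  homo-det x = trans (+-homo _ _)
    (cong₂ S._+_ (trans (+-homo _ _) (cong₂ S._+_ (homo-cofactor _ _ _ _ _)
                                                    (trans (-‿homo _) (cong S.-_ (homo-cofactor _ _ _ _ _)))))
                 (homo-cofactor _ _ _ _ _))

  mapᴹ-cube : ∀ a → mapᴹ f (cube R a) ≡ cube S (mapᴹ f a)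
  mapᴹ-cube a = trans (mapᴹ-· a _) (cong (_·_ S (mapᴹ f a)) (mapᴹ-· a a))

  mapᴹ-fourth : ∀ c → mapᴹ f (fourth R c) ≡ fourth S (mapᴹ f c)
  mapᴹ-fourth c = trans (mapᴹ-· c _) (cong (_·_ S (mapᴹ f c)) (mapᴹ-cube c))

  Adj-homo : ∀ {a b} → Adj R a b → Adj S (mapᴹ f a) (mapᴹ f b)
  Adj-homo {a} {b} adj = begin
    fourth S (_·_ S (mapᴹ f a) (mapᴹ f b)) ≡⟨ cong (fourth S) (mapᴹ-· a b) ⟨
    fourth S (mapᴹ f (_·_ R a b))          ≡⟨ mapᴹ-fourth (_·_ R a b) ⟨
    mapᴹ f (fourth R (_·_ R a b))          ≡⟨ cong (mapᴹ f) adj ⟩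
    mapᴹ f (I3 R)                          ≡⟨ mapᴹ-I3 ⟩
    I3 S                                   ∎
    where open ≡-Reasoning

  NoOrder3InKernel : Set
  NoOrder3InKernel = ∀ a → cube R a ≡ I3 R → mapᴹ f a ≡ I3 S → a ≡ I3 R

  IsVertex-homo : NoOrder3InKernel → ∀ {a} → IsVertex R a → IsVertex S (mapᴹ f a)
  IsVertex-homo trivial {a} (det≡1 , cube≡I , a≢I) =
    trans (sym (homo-det a)) (trans (cong f det≡1) 1#-homo) ,
    trans (sym (mapᴹ-cube a)) (trans (cong (mapᴹ f) cube≡I) mapᴹ-I3) ,
    a≢I ∘ trivial a cube≡I

  colorable-pullback : NoOrder3InKernel → ∀ {k} → Colorable S k → Colorable R k
  colorable-pullback trivial (c , proper) =
    c ∘ mapᴹ f ,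
    λ a b va vb adj → proper _ _ (IsVertex-homo trivial va) (IsVertex-homo trivial vb) (Adj-homo adj)

infix 4 _≡_mod_
record _≡_mod_ (x y : ℤ) (n : ℕ) : Set where
  constructor congruent
  field n∣x-y : + n ∣ x - y
open _≡_mod_

module _ {n : ℕ} where
  ≡-mod-sym : ∀ {x y} → x ≡ y mod n → y ≡ x mod n
  ≡-mod-sym {x} {y} (congruent n∣x-y) = congruent (subst (+ n ∣_) (identity x y) (∣m⇒∣-m n∣x-y))
    where
    identity : ∀ x y → - (x - y) ≡ y - x
    identity = solve-∀

  ≡-mod-trans : ∀ {x y z} → x ≡ y mod n → y ≡ z mod n → x ≡ z mod n
  ≡-mod-trans {x} {y} {z} (congruent n∣x-y) (congruent n∣y-z) =
    congruent (subst (+ n ∣_) (identity x y z) (∣m∣n⇒∣m+n n∣x-y n∣y-z))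
    where
    identity : ∀ x y z → (x - y) + (y - z) ≡ x - z
    identity = solve-∀

  +-cong-mod : ∀ {x x′ y y′} → x ≡ x′ mod n → y ≡ y′ mod n → x + y ≡ x′ + y′ mod n
  +-cong-mod {x} {x′} {y} {y′} (congruent n∣x-x′) (congruent n∣y-y′) =
    congruent (subst (+ n ∣_) (identity x x′ y y′) (∣m∣n⇒∣m+n n∣x-x′ n∣y-y′))
    where
    identity : ∀ x x′ y y′ → (x - x′) + (y - y′) ≡ (x + y) - (x′ + y′)
    identity = solve-∀

  *-cong-mod : ∀ {x x′ y y′} → x ≡ x′ mod n → y ≡ y′ mod n → x * y ≡ x′ * y′ mod n
  *-cong-mod {x} {x′} {y} {y′} (congruent n∣x-x′) (congruent n∣y-y′) =
    congruent (subst (+ n ∣_) (identity x x′ y y′) (∣m∣n⇒∣m+n (∣n⇒∣m*n x n∣y-y′) (∣m⇒∣m*n y′ n∣x-x′)))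
    where
    identity : ∀ x x′ y y′ → x * (y - y′) + (x - x′) * y′ ≡ x * y - x′ * y′
    identity = solve-∀

  -‿cong-mod : ∀ {x x′} → x ≡ x′ mod n → - x ≡ - x′ mod n
  -‿cong-mod {x} {x′} (congruent n∣x-x′) = congruent (subst (+ n ∣_) (identity x x′) (∣m⇒∣-m n∣x-x′))
    where
    identity : ∀ x x′ → - (x - x′) ≡ - x - - x′
    identity = solve-∀

n∣i∧∣i∣<n⇒i≡0 : ∀ {n i} → ∣ i ∣ ℕ.< n → + n ∣ i → i ≡ 0ℤ
n∣i∧∣i∣<n⇒i≡0 {n} {i} ∣i∣<n n∣i with ∣ i ∣ in ∣i∣≡
... | ℕ.zero  = ℤ.∣i∣≡0⇒i≡0 ∣i∣≡
... | ℕ.suc _ = ⊥-elim (ℕ.>⇒∤ ∣i∣<n (subst (n ℕ.∣_) ∣i∣≡ (∣⇒∣ᵤ n∣i)))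

∣m⊖n∣<o : ∀ {m n o} → m ℕ.< o → n ℕ.< o → ∣ m ℤ.⊖ n ∣ ℕ.< o
∣m⊖n∣<o {m} {n} {o} m<o n<o with ℕ.≤-total m n
... | inj₁ m≤n = subst (ℕ._< o) (sym (ℤ.∣⊖∣-≤ m≤n)) (ℕ.≤-<-trans (ℕ.m∸n≤m n m) n<o)
... | inj₂ n≤m = subst (ℕ._< o) (sym (trans (ℤ.∣m⊖n∣≡∣n⊖m∣ m n) (ℤ.∣⊖∣-≤ n≤m)))
                       (ℕ.≤-<-trans (ℕ.m∸n≤m m n) m<o)

≡-mod⇒≡ : ∀ {n a b} → a ℕ.< n → b ℕ.< n → + a ≡ + b mod n → a ≡ b
≡-mod⇒≡ {n} {a} {b} a<n b<n (congruent n∣a-b) =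
  ℤ.+-injective (ℤ.i-j≡0⇒i≡j (+ a) (+ b) (n∣i∧∣i∣<n⇒i≡0 ∣a-b∣<n n∣a-b))
  where
  ∣a-b∣<n : ∣ + a - + b ∣ ℕ.< n
  ∣a-b∣<n = subst (ℕ._< n) (cong ∣_∣ (sym (ℤ.m-n≡m⊖n a b))) (∣m⊖n∣<o a<n b<n)

module Reduction (n : ℕ) .{{_ : ℕ.NonZero n}} where
  ℤ/n : Ops
  ℤ/n = ZModOps' n

  -- reduce (+ m) is definitionally m mod n
  reduce : ℤ → Fin n
  reduce x = fromℕ< (n%ℕd<d x n)

  lift : Fin n → ℤ
  lift a = + toℕ a

  ≡-lift-reduce : ∀ x → x ≡ lift (reduce x) mod n
  ≡-lift-reduce x = congruent (divides (x /ℕ n) (begin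
    x - lift (reduce x)                       ≡⟨ cong (λ r → x - + r) (toℕ-fromℕ< _) ⟩
    x - + (x %ℕ n)                            ≡⟨ cong (_- + (x %ℕ n)) (a≡a%ℕn+[a/ℕn]*n x n) ⟩
    (+ (x %ℕ n) + x /ℕ n * + n) - + (x %ℕ n)  ≡⟨ identity (+ (x %ℕ n)) (x /ℕ n * + n) ⟩
    x /ℕ n * + n                              ∎))
    where
    open ≡-Reasoning
    identity : ∀ r k → (r + k) - r ≡ k
    identity = solve-∀

  ≡-mod⇒reduce-≡ : ∀ {x y} → x ≡ y mod n → reduce x ≡ reduce y
  ≡-mod⇒reduce-≡ {x} {y} x≡y = toℕ-injective (≡-mod⇒≡ (toℕ<n _) (toℕ<n _)
    (≡-mod-trans (≡-mod-sym (≡-lift-reduce x)) (≡-mod-trans x≡y (≡-lift-reduce y))))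

  reduce-≡⇒≡-mod : ∀ {x y} → reduce x ≡ reduce y → x ≡ y mod n
  reduce-≡⇒≡-mod {x} {y} rx≡ry = ≡-mod-trans (≡-lift-reduce x)
    (subst (λ r → lift r ≡ y mod n) (sym rx≡ry) (≡-mod-sym (≡-lift-reduce y)))

  -lift≡n∸lift : ∀ a → - lift a ≡ + (n ℕ.∸ toℕ a) mod n
  -lift≡n∸lift a =
    congruent (subst (+ n ∣_) (trans (identity (lift a) (+ n)) (cong (λ z → - lift a - z) n-a)) (∣m⇒∣-m ∣-refl))
    where
    identity : ∀ l m → - m ≡ - l - (m - l)
    identity = solve-∀
    n-a : + n - lift a ≡ + (n ℕ.∸ toℕ a)
    n-a = trans (ℤ.m-n≡m⊖n n (toℕ a)) (ℤ.⊖-≥ (ℕ.<⇒≤ (toℕ<n a)))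

  reduce-isRingHomomorphism : IsRingHomomorphism ℤOps ℤ/n reduce
  reduce-isRingHomomorphism = record
    { 0#-homo = refl
    ; 1#-homo = refl
    ; +-homo  = λ x y → ≡-mod⇒reduce-≡
        (subst (x + y ≡_mod n) (sym (ℤ.pos-+ (toℕ (reduce x)) (toℕ (reduce y))))
               (+-cong-mod (≡-lift-reduce x) (≡-lift-reduce y)))
    ; *-homo  = λ x y → ≡-mod⇒reduce-≡
        (subst (x * y ≡_mod n) (sym (ℤ.pos-* (toℕ (reduce x)) (toℕ (reduce y))))
               (*-cong-mod (≡-lift-reduce x) (≡-lift-reduce y)))
    ; -‿homo  = λ x → ≡-mod⇒reduce-≡
        (≡-mod-trans (-‿cong-mod (≡-lift-reduce x)) (-lift≡n∸lift (reduce x)))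
    }

x-y≡e*q⇒y+q*e≡x : ∀ {x y e q} → x - y ≡ e * q → y + q * e ≡ x
x-y≡e*q⇒y+q*e≡x {x} {y} {e} {q} eq =
  trans (cong (λ z → y + z) (trans (ℤ.*-comm q e) (sym eq))) (identity x y)
  where
  identity : ∀ x y → y + (x - y) ≡ x
  identity = solve-∀

-- Cube roots of the identity modulo powers of a prime

prime∣3⇒≡3 : ∀ {p} → Prime p → p ℕ.∣ 3 → p ≡ 3
prime∣3⇒≡3 pr p∣3 with prime⇒irreducible (toWitness {a? = prime? 3} _) p∣3
... | inj₁ refl = ⊥-elim (¬prime[1] pr)
... | inj₂ p≡3  = p≡3

prime≢3∧∣3*e⇒∣e : ∀ {p e} → Prime p → p ≢ 3 → + p ∣ + 3 * e → + p ∣ e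
prime≢3∧∣3*e⇒∣e {p} {e} pr p≢3 p∣3e
  with euclidsLemma 3 ∣ e ∣ pr (subst (p ℕ.∣_) (ℤ.abs-* (+ 3) e) (∣⇒∣ᵤ p∣3e))
... | inj₁ p∣3   = ⊥-elim (p≢3 (prime∣3⇒≡3 pr p∣3))
... | inj₂ p∣∣e∣ = ∣ᵤ⇒∣ p∣∣e∣

-- For p = 3 the factor 3 in the quadratic term is what makes the argument work.
prime∣linear-coefficient : ∀ {p q} → Prime p → + p ∣ q → ∀ e z y →
  + 3 * e + q * (+ 3 * z + q * y) ≡ 0ℤ → + p ∣ e
prime∣linear-coefficient {p} pr (divides c refl) e z y h with p ℕ.≟ 3
... | yes refl = divides (- (c * (z + c * y)))
  (ℤ.*-cancelˡ-≡ (+ 3) _ _ (trans (inverseˡ-unique _ _ h) (identity c z y)))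
  where
  identity : ∀ c z y →
    - ((c * + 3) * (+ 3 * z + (c * + 3) * y)) ≡ + 3 * (- (c * (z + c * y)) * + 3)
  identity = solve-∀
... | no p≢3 = prime≢3∧∣3*e⇒∣e pr p≢3
  (subst (+ p ∣_) (sym (inverseˡ-unique _ _ h)) (∣m⇒∣-m (∣m⇒∣m*n _ (∣n⇒∣m*n c ∣-refl))))

infixl 7 _●_
_●_ : M3 ℤ → M3 ℤ → M3 ℤ
_●_ = _·_ ℤOps

Expr : ℕ → Ops
Expr n = record { Car = Polynomial n ; 0# = con 0ℤ ; 1# = con 1ℤ ; _+_ = _:+_ ; _*_ = _:*_ ; -_ = :-_ }

-- Each entry is an identity of integer polynomials in q and the entries of E: both sides are the
-- evaluations at ρ of the polynomial expressions lhs and rhs, which have the same normal form.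
cube-I+ : ∀ q E i j → entry (cube ℤOps (I+ ℤOps q E)) i j
  ≡ entry (I3 ℤOps) i j
    + q * (+ 3 * entry E i j + q * (+ 3 * entry (E ● E) i j + q * entry (cube ℤOps E) i j))
cube-I+ q (mk e11 e12 e13 e21 e22 e23 e31 e32 e33) = λ where
    zero             zero             → by-normal-form zero zero refl
    zero             (suc zero)       → by-normal-form zero (suc zero) refl
    zero             (suc (suc zero)) → by-normal-form zero (suc (suc zero)) refl
    (suc zero)       zero             → by-normal-form (suc zero) zero refl
    (suc zero)       (suc zero)       → by-normal-form (suc zero) (suc zero) refl
    (suc zero)       (suc (suc zero)) → by-normal-form (suc zero) (suc (suc zero)) refl
    (suc (suc zero)) zero             → by-normal-form (suc (suc zero)) zero refl
    (suc (suc zero)) (suc zero)       → by-normal-form (suc (suc zero)) (suc zero) refl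
    (suc (suc zero)) (suc (suc zero)) → by-normal-form (suc (suc zero)) (suc (suc zero)) refl
  where
  ρ : Vec ℤ 10
  ρ = q ∷ e11 ∷ e12 ∷ e13 ∷ e21 ∷ e22 ∷ e23 ∷ e31 ∷ e32 ∷ e33 ∷ []
  q′ : Polynomial 10
  q′ = var (# 0)
  E′ : M3 (Polynomial 10)
  E′ = mk (var (# 1)) (var (# 2)) (var (# 3))
          (var (# 4)) (var (# 5)) (var (# 6))
          (var (# 7)) (var (# 8)) (var (# 9))
  lhs rhs : Fin 3 → Fin 3 → Polynomial 10
  lhs i j = entry (cube (Expr 10) (I+ (Expr 10) q′ E′)) i j
  rhs i j = entry (I3 (Expr 10)) i j :+ q′ :* (con (+ 3) :* entry E′ i j
              :+ q′ :* (con (+ 3) :* entry (_·_ (Expr 10) E′ E′) i j :+ q′ :* entry (cube (Expr 10) E′) i j))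
  by-normal-form : ∀ i j → ⟦ lhs i j ⟧↓ ρ ≡ ⟦ rhs i j ⟧↓ ρ → ⟦ lhs i j ⟧ ρ ≡ ⟦ rhs i j ⟧ ρ
  by-normal-form i j = prove ρ (lhs i j) (rhs i j)

n<m^n : ∀ {m} → 1 ℕ.< m → ∀ n → n ℕ.< m ℕ.^ n
n<m^n 1<m ℕ.zero    = ℕ.z<s
n<m^n {m} 1<m (ℕ.suc n) = ℕ.≤-<-trans (n<m^n 1<m n) (ℕ.^-monoʳ-< m 1<m (ℕ.n<1+n n))

∣-all-powers⇒≡0 : ∀ {m i} → 1 ℕ.< m → (∀ k → + (m ℕ.^ ℕ.suc k) ∣ i) → i ≡ 0ℤ
∣-all-powers⇒≡0 {i = i} 1<m m^k∣i =
  n∣i∧∣i∣<n⇒i≡0 (ℕ.<-trans (ℕ.n<1+n ∣ i ∣) (n<m^n 1<m _)) (m^k∣i ∣ i ∣)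

infix 4 _≡ᴹ_mod_
_≡ᴹ_mod_ : M3 ℤ → M3 ℤ → ℕ → Set
x ≡ᴹ y mod m = ∀ i j → entry x i j ≡ entry y i j mod m

≡ᴹ-all-powers⇒≡ : ∀ {m x y} → 1 ℕ.< m → (∀ k → x ≡ᴹ y mod m ℕ.^ ℕ.suc k) → x ≡ y
≡ᴹ-all-powers⇒≡ 1<m h = M3-ext λ i j → ℤ.i-j≡0⇒i≡j _ _ (∣-all-powers⇒≡0 1<m λ k → n∣x-y (h k i j))

module _ {p : ℕ} (pr : Prime p) where
  private instance
    p≢0 : ℕ.NonZero p
    p≢0 = prime⇒nonZero pr

  open Reduction p
  open MatrixHomomorphism reduce-isRingHomomorphism

  ≡ᴹI-lift : ∀ {a} → cube ℤOps a ≡ I3 ℤOps → ∀ m .{{_ : ℕ.NonZero m}} → p ℕ.∣ m →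
    a ≡ᴹ I3 ℤOps mod m → a ≡ᴹ I3 ℤOps mod (p ℕ.* m)
  ≡ᴹI-lift {a} a³≡I m p∣m a≡I i j = congruent (pm∣a-I i j)
    where
    e : Fin 3 → Fin 3 → ℤ
    e i j = quotient (n∣x-y (a≡I i j))

    difference : ∀ i j → entry a i j - entry (I3 ℤOps) i j ≡ e i j * + m
    difference i j = _∣_.equality (n∣x-y (a≡I i j))

    E : M3 ℤ
    E = tabulate e

    a≡I+mE : a ≡ I+ ℤOps (+ m) E
    a≡I+mE = M3-ext λ i j → sym (begin
      entry (I+ ℤOps (+ m) E) i j          ≡⟨ entry-tabulate (λ i j → entry (I3 ℤOps) i j + + m * entry E i j) i j ⟩
      entry (I3 ℤOps) i j + + m * entry E i j ≡⟨ cong (λ x → entry (I3 ℤOps) i j + + m * x) (entry-tabulate e i j) ⟩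
      entry (I3 ℤOps) i j + + m * e i j    ≡⟨ x-y≡e*q⇒y+q*e≡x {e = e i j} {q = + m} (difference i j) ⟩
      entry a i j                          ∎)
      where open ≡-Reasoning

    linear-coefficient : ∀ i j →
      + 3 * entry E i j + + m * (+ 3 * entry (E ● E) i j + + m * entry (cube ℤOps E) i j) ≡ 0ℤ
    linear-coefficient i j = ℤ.*-cancelˡ-≡ (+ m) _ 0ℤ (trans (∙-cancelˡ (entry (I3 ℤOps) i j) _ _ (begin
      entry (I3 ℤOps) i j + + m * _            ≡⟨ cube-I+ (+ m) E i j ⟨
      entry (cube ℤOps (I+ ℤOps (+ m) E)) i j  ≡⟨ cong (λ x → entry (cube ℤOps x) i j) a≡I+mE ⟨
      entry (cube ℤOps a) i j                  ≡⟨ cong (λ x → entry x i j) a³≡I ⟩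
      entry (I3 ℤOps) i j                      ≡⟨ ℤ.+-identityʳ _ ⟨
      entry (I3 ℤOps) i j + 0ℤ                 ∎)) (sym (ℤ.*-zeroʳ (+ m))))
      where open ≡-Reasoning

    p∣e : ∀ i j → + p ∣ e i j
    p∣e i j = subst (+ p ∣_) (entry-tabulate e i j)
      (prime∣linear-coefficient {q = + m} pr (∣ᵤ⇒∣ p∣m)
        (entry E i j) (entry (E ● E) i j) (entry (cube ℤOps E) i j) (linear-coefficient i j))

    pm∣a-I : ∀ i j → + (p ℕ.* m) ∣ entry a i j - entry (I3 ℤOps) i j
    pm∣a-I i j = begin
      + (p ℕ.* m)                        ≡⟨ ℤ.pos-* p m ⟩
      + p * + m                          ∣⟨ *-monoˡ-∣ (+ m) (p∣e i j) ⟩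
      e i j * + m                        ≡⟨ difference i j ⟨
      entry a i j - entry (I3 ℤOps) i j  ∎
      where open ∣-Reasoning

  reduce-a≡I⇒≡ᴹI-mod-p : ∀ {a} → mapᴹ reduce a ≡ I3 ℤ/n → a ≡ᴹ I3 ℤOps mod p
  reduce-a≡I⇒≡ᴹI-mod-p {a} ra≡I i j = reduce-≡⇒≡-mod (begin
    reduce (entry a i j)                 ≡⟨ entry-mapᴹ reduce a i j ⟨
    entry (mapᴹ reduce a) i j            ≡⟨ cong (λ x → entry x i j) (trans ra≡I (sym mapᴹ-I3)) ⟩
    entry (mapᴹ reduce (I3 ℤOps)) i j    ≡⟨ entry-mapᴹ reduce (I3 ℤOps) i j ⟩
    reduce (entry (I3 ℤOps) i j)         ∎)
    where open ≡-Reasoning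

  reduction-kernel-has-no-order-3 : NoOrder3InKernel
  reduction-kernel-has-no-order-3 a a³≡I ra≡I =
    ≡ᴹ-all-powers⇒≡ (ℕ.nonTrivial⇒n>1 p {{prime⇒nonTrivial pr}}) ≡I-mod-p^
    where
    ≡I-mod-p^ : ∀ k → a ≡ᴹ I3 ℤOps mod p ℕ.^ ℕ.suc k
    ≡I-mod-p^ ℕ.zero    = subst (a ≡ᴹ I3 ℤOps mod_) (sym (ℕ.*-identityʳ p)) (reduce-a≡I⇒≡ᴹI-mod-p ra≡I)
    ≡I-mod-p^ (ℕ.suc k) =
      ≡ᴹI-lift a³≡I (p ℕ.^ ℕ.suc k) {{ℕ.m^n≢0 p (ℕ.suc k)}} (ℕ.m∣m*n (p ℕ.^ k)) (≡I-mod-p^ k)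

theorem1 : (p : ℕ) (pr : Prime p) (n : ℕ) →
    IsChromaticNumber (ZModOps p pr) n → Colorable ℤOps n
theorem1 p pr n (n-colorable , _) = colorable-pullback (reduction-kernel-has-no-order-3 pr) n-colorable
  where
  open Reduction p {{prime⇒nonZero pr}}
  open MatrixHomomorphism reduce-isRingHomomorphism
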